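{- Let $G$ be a finite non-cyclic abelian group with \[G\cong\mathbb{Z}_{p_1^{t_{11}}}\times\cdots\times\mathbb{Z}_{p_1^{t_{1k_1}}}\times\mathbb{Z}_{p_2^{t_{21}}}\times\cdots\times\mathbb{Z}_{p_2^{t_{2k_2}}}\times\cdots\times\mathbb{Z}_{p_r^{t_{r1}}}\times\cdots\times\mathbb{Z}_{p_r^{t_{rk_r}}},\] where $p_1,\dots,p_r$ are distinct primes, $k_i\ge 1$ and $1\le t_{i1}\le t_{i2}\le\cdots\le t_{ik_i}$ for all $i\in\{1,\dots,r\}$. Then \[\kappa(\mathcal{G}_e(G))\le p_1^{t_{11}}p_2^{t_{21}}\cdots p_r^{t_{r1}}-\phi\big(p_1^{t_{11}}p_2^{t_{21}}\cdots p_r^{t_{r1}}\big),\] where $\phi$ is Euler's totient function.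
   Context: For a finite group $G$, the enhanced power graph $\mathcal{G}_e(G)$ is the simple graph with vertex set $G$ in which two distinct vertices $u,v$ are adjacent if and only if there exists $w\in G$ such that both $u$ and $v$ are powers of $w$. For a graph $\Gamma$, the vertex connectivity $\kappa(\Gamma)$ is the minimum number of vertices whose removal leaves an induced subgraph that is disconnected. -}

module Defs where

open import Data.Nat using (ℕ; zero; suc; _*_; _^_; _≤_; _%_; _≟_)
open import Data.Nat.DivMod using (m%n<n)
open import Data.Nat.GCD using (gcd)
open import Data.Nat.Primality using (Prime)
open import Data.Fin using (Fin; toℕ; fromℕ<)
open import Data.List using (List; []; _∷_; map; concatMap; length; filter; upTo)
open import Data.Nat.ListAction using (product)
open import Data.Empty using (⊥)
open import Data.List.Membership.Propositional using (_∈_; _∉_)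
open import Data.List.Relation.Unary.All using (All)
open import Data.List.Relation.Unary.Unique.Propositional using (Unique)
open import Data.List.Relation.Unary.Linked using (Linked)
open import Data.Unit using (⊤; tt)
open import Data.Product using (Σ; _×_; _,_; ∃; ∃-syntax; proj₁; proj₂)
open import Relation.Binary.PropositionalEquality using (_≡_; _≢_)
open import Relation.Nullary using (¬_)

-- The concrete abelian group  Z_{n₁} × ⋯ × Z_{n_m}  (list of moduli)

Elem : List ℕ → Set
Elem []       = ⊤
Elem (n ∷ ns) = Fin n × Elem ns

-- a-th power (additively: a-fold multiple) in Z_n
cpow : ∀ {n} → ℕ → Fin n → Fin n
cpow {suc m} a x = fromℕ< (m%n<n (a * toℕ x) (suc m))

pow : ∀ {ns} → ℕ → Elem ns → Elem ns
pow {[]}     a _        = tt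
pow {n ∷ ns} a (x , xs) = cpow a x , pow a xs

IsCyclic : List ℕ → Set
IsCyclic ns = ∃[ g ] ∀ (x : Elem ns) → ∃[ a ] x ≡ pow a g

EAdj : ∀ {ns} → Elem ns → Elem ns → Set
EAdj {ns} u v = (u ≢ v) × (∃[ w ] ∃[ a ] ∃[ b ] (u ≡ pow a w × v ≡ pow b w))

data Reach {ns} (S : List (Elem ns)) : Elem ns → Elem ns → Set where
  here : ∀ {u} → Reach S u u
  step : ∀ {u v x} → Reach S u v → EAdj v x → x ∉ S → Reach S u x

Separating : ∀ {ns} → List (Elem ns) → Set
Separating {ns} S =
  Unique S × (∃[ u ] ∃[ v ] (u ∉ S × v ∉ S × ¬ Reach S u v))

IsVertexConnectivity : List ℕ → ℕ → Set
IsVertexConnectivity ns k =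
  (∃[ S ] (Separating {ns} S × length S ≡ k))
  × (∀ (S : List (Elem ns)) → Separating S → k ≤ length S)

φ : ℕ → ℕ
φ n = length (filter (λ k → gcd k n ≟ 1) (map suc (upTo n)))

-- Primary decomposition data: a list of blocks (pᵢ , [tᵢ₁ , … , tᵢₖᵢ])

Block : Set
Block = ℕ × List ℕ

moduli : List Block → List ℕ
moduli = concatMap (λ b → map (proj₁ b ^_) (proj₂ b))

NonEmpty : List ℕ → Set
NonEmpty []      = ⊥
NonEmpty (_ ∷ _) = ⊤

headOr0 : List ℕ → ℕ
headOr0 []      = 0
headOr0 (t ∷ _) = t

ValidBlock : Block → Set
ValidBlock (p , ts) = Prime p × NonEmpty ts × All (1 ≤_) ts × Linked _≤_ ts

bound : List Block → ℕ
bound bs = product (map (λ b → proj₁ b ^ headOr0 (proj₂ b)) bs)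

module Submission where

-- Call the first cyclic factor Z_{pᵢ^{tᵢ₁}} of each prime its leading factor.  The elements
-- of G supported on the leading factors form a subgroup T ≅ Z_n (Chinese remainder theorem),
-- and the generators U of T are the elements of T whose leading coordinates are prime to
-- their pᵢ; there are at least φ n of them.  The set S = T ∖ U, of size n ∸ |U| ≤ n ∸ φ n,
-- separates the graph: if w^a lies in U then a is prime to every pᵢ, which forces w, and so
-- every power of w, into T.  Hence a walk from a generator of T that avoids S stays in U,
-- and never reaches the elements outside T, which exist because G is not cyclic.

open import Defs
open import Data.Bool using (Bool; true; false)
open import Data.Nat using (ℕ; zero; suc; pred; _+_; _*_; _∸_; _^_; _≤_; _<_; _%_; _/_; z≤n; s≤s; _≟_; NonZero; nonTrivial⇒n>1)
open import Data.Nat.Properties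
open import Data.Nat.Induction using (<-rec)
open import Data.Nat.DivMod using (m%n<n; %-distribˡ-*; m∣n⇒o%n%m≡o%m; m%n%n≡m%n; m≡m%n+[m/n]*n)
open import Data.Nat.Divisibility
open import Data.Nat.GCD using (gcd; gcd-greatest; gcd[m,n]∣m)
open import Data.Nat.Primality using (Prime; prime; euclidsLemma; prime⇒irreducible; prime⇒nonZero)
open import Data.Nat.ListAction using (product)
open import Data.Fin as Fin using (Fin; toℕ; fromℕ<)
import Data.Fin.Properties as Fin
open import Data.List using (List; []; _∷_; map; length; filter; upTo; allFin; cartesianProduct; _++_)
open import Data.List.Properties using (length-++; length-map; length-upTo; length-tabulate; map-++)
open import Data.List.Membership.Propositional using (_∈_; _∉_; find; lose)
open import Data.List.Membership.Propositional.Properties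
open import Data.List.Membership.DecPropositional using (_∈?_)
open import Data.List.Relation.Unary.Any as Any using (Any; here; there; any?)
open import Data.List.Relation.Unary.All as All using (All; []; _∷_)
import Data.List.Relation.Unary.All.Properties as All
open import Data.List.Relation.Unary.AllPairs using (allPairs?; []; _∷_)
open import Data.List.Relation.Unary.Unique.Propositional using (Unique)
import Data.List.Relation.Unary.Unique.Propositional.Properties as Unique
open import Data.Unit using (⊤; tt)
open import Data.Empty using (⊥-elim)
open import Data.Sum using (_⊎_; inj₁; inj₂)
open import Data.Product using (_×_; _,_; ∃; ∃-syntax; proj₁; proj₂; uncurry)
open import Function using (_∘_)
open import Relation.Binary.PropositionalEquality
open import Relation.Binary.Definitions using (DecidableEquality)
open import Relation.Nullary using (¬_; Dec; yes; no; ¬?)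
open import Relation.Nullary.Decidable using (_×-dec_)
open import Relation.Unary using (Decidable)

InjectiveOn : {A B : Set} → (A → B) → List A → Set
InjectiveOn f xs = ∀ {x y} → x ∈ xs → y ∈ xs → f x ≡ f y → x ≡ y

MapsInto : {A B : Set} → (A → B) → List A → List B → Set
MapsInto f xs ys = ∀ {x} → x ∈ xs → f x ∈ ys

remove-member : ∀ {A : Set} {x : A} {ys : List A} → x ∈ ys
  → ∃[ zs ] (length ys ≡ suc (length zs) × (∀ {y} → y ∈ ys → y ≢ x → y ∈ zs))
remove-member {ys = _ ∷ ys} (here refl) =
  ys , refl , λ { (here refl) y≢x → ⊥-elim (y≢x refl) ; (there y∈ys) _ → y∈ys }
remove-member {ys = y ∷ ys} (there x∈ys) with remove-member x∈ys
... | zs , len , keep =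
  y ∷ zs , cong suc len , λ { (here refl) _ → here refl ; (there y∈ys) y≢x → there (keep y∈ys y≢x) }

injection-length : ∀ {A B : Set} (f : A → B) {xs : List A} {ys : List B}
  → Unique xs → MapsInto f xs ys → InjectiveOn f xs → length xs ≤ length ys
injection-length f {[]} _ _ _ = z≤n
injection-length f {x ∷ xs} (x∉xs ∷ uxs) into inj with remove-member (into (here refl))
... | zs , len , keep =
  subst (suc (length xs) ≤_) (sym len) (s≤s (injection-length f uxs into′ (λ a b → inj (there a) (there b))))
  where
  into′ : MapsInto f xs zs
  into′ y∈xs = keep (into (there y∈xs))
    (λ fy≡fx → All.lookup x∉xs y∈xs (inj (here refl) (there y∈xs) (sym fy≡fx)))

injection-onto : ∀ {A B : Set} → DecidableEquality B → (f : A → B) {xs : List A} {ys : List B}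
  → Unique xs → MapsInto f xs ys → InjectiveOn f xs → length ys ≤ length xs
  → ∀ {y} → y ∈ ys → ∃[ x ] (x ∈ xs × f x ≡ y)
injection-onto _≟ᴮ_ f {xs} uxs into inj short {y} y∈ys with any? (λ x → f x ≟ᴮ y) xs
... | yes hit = find hit
... | no miss with remove-member y∈ys
...   | zs , len , keep = ⊥-elim (1+n≰n (≤-trans (subst (_≤ length xs) len short) xs≤zs))
  where
  xs≤zs : length xs ≤ length zs
  xs≤zs = injection-length f uxs (λ x∈xs → keep (into x∈xs) (miss ∘ lose x∈xs)) inj

length-filter-split : ∀ {A : Set} {P : A → Set} (P? : Decidable P) xs
  → length (filter P? xs) + length (filter (¬? ∘ P?) xs) ≡ length xs
length-filter-split P? [] = refl
length-filter-split P? (x ∷ xs) with P? x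
... | yes _ = cong suc (length-filter-split P? xs)
... | no _ = trans (+-suc _ _) (cong suc (length-filter-split P? xs))

length-cartesianProduct : ∀ {A B : Set} (xs : List A) (ys : List B)
  → length (cartesianProduct xs ys) ≡ length xs * length ys
length-cartesianProduct [] ys = refl
length-cartesianProduct (x ∷ xs) ys =
  trans (length-++ (map (x ,_) ys)) (cong₂ _+_ (length-map (x ,_) ys) (length-cartesianProduct xs ys))

least-witness : ∀ {P : ℕ → Set} → Decidable P → ∀ m → P m → ∃[ k ] (P k × (∀ j → P j → k ≤ j))
least-witness {P} P? = <-rec _ search
  where
  search : ∀ m → (∀ {j} → j < m → P j → ∃[ k ] (P k × (∀ i → P i → k ≤ i)))
    → P m → ∃[ k ] (P k × (∀ i → P i → k ≤ i))
  search m smaller pm with anyUpTo? P? m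
  ... | yes (j , j<m , pj) = smaller j<m pj
  ... | no none = m , pm , λ j pj → ≮⇒≥ (λ j<m → none (j , j<m , pj))

prime≢1 : ∀ {p} → Prime p → p ≢ 1
prime≢1 {.1} (prime {{()}} _) refl

prime∣^⇒∣ : ∀ {p q} → Prime p → ∀ s → p ∣ q ^ s → p ∣ q
prime∣^⇒∣ pp zero p∣1 = ⊥-elim (prime≢1 pp (∣1⇒≡1 p∣1))
prime∣^⇒∣ {q = q} pp (suc s) p∣q^s+1 with euclidsLemma q (q ^ s) pp p∣q^s+1
... | inj₁ p∣q = p∣q
... | inj₂ p∣q^s = prime∣^⇒∣ pp s p∣q^s

prime∣prime⇒≡ : ∀ {p q} → Prime p → Prime q → p ∣ q → p ≡ q
prime∣prime⇒≡ pp pq p∣q with prime⇒irreducible pq p∣q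
... | inj₁ p≡1 = ⊥-elim (prime≢1 pp p≡1)
... | inj₂ p≡q = p≡q

prime^∣*-cancel : ∀ {p k} → Prime p → ¬ p ∣ k → ∀ t {w} → p ^ t ∣ k * w → p ^ t ∣ w
prime^∣*-cancel pp p∤k zero {w} _ = 1∣ w
prime^∣*-cancel {p} {k} pp p∤k (suc t) {w} h with euclidsLemma k w pp (∣-trans (m∣m*n (p ^ t)) h)
... | inj₁ p∣k = ⊥-elim (p∤k p∣k)
... | inj₂ (divides q refl) = subst (p * p ^ t ∣_) (*-comm p q) (*-monoʳ-∣ p p^t∣q)
  where
  instance
    p≢0 : NonZero p
    p≢0 = prime⇒nonZero pp
  rearrange : k * (q * p) ≡ p * (k * q)
  rearrange = trans (sym (*-assoc k q p)) (*-comm (k * q) p)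
  p^t∣q : p ^ t ∣ q
  p^t∣q = prime^∣*-cancel pp p∤k t (*-cancelˡ-∣ p (subst (p * p ^ t ∣_) rearrange h))

prime^*-∣ : ∀ {p t M d} → Prime p → ¬ p ∣ M → p ^ t ∣ d → M ∣ d → p ^ t * M ∣ d
prime^*-∣ {p} {t} {M} pp p∤M h (divides c refl)
  with prime^∣*-cancel pp p∤M t (subst (p ^ t ∣_) (*-comm c M) h)
... | divides c′ refl = divides c′ (*-assoc c′ (p ^ t) M)

%≡⇒∣∸ : ∀ m .{{_ : NonZero m}} k k′ → k % m ≡ k′ % m → m ∣ k′ ∸ k
%≡⇒∣∸ m k k′ eq = divides (k′ / m ∸ k / m) (begin
  k′ ∸ k                                         ≡⟨ cong₂ _∸_ (m≡m%n+[m/n]*n k′ m) (m≡m%n+[m/n]*n k m) ⟩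
  (k′ % m + k′ / m * m) ∸ (k % m + k / m * m)    ≡⟨ cong (λ r → (r + k′ / m * m) ∸ (k % m + k / m * m)) (sym eq) ⟩
  (k % m + k′ / m * m) ∸ (k % m + k / m * m)     ≡⟨ [m+n]∸[m+o]≡n∸o (k % m) _ _ ⟩
  k′ / m * m ∸ k / m * m                         ≡⟨ sym (*-distribʳ-∸ m (k′ / m) (k / m)) ⟩
  (k′ / m ∸ k / m) * m                           ∎)
  where open ≡-Reasoning

∣∧<⇒≡0 : ∀ {d a} → d ∣ a → a < d → a ≡ 0
∣∧<⇒≡0 {a = zero} _ _ = refl
∣∧<⇒≡0 {a = suc a} d∣a a<d = ⊥-elim (<⇒≱ a<d (∣⇒≤ d∣a))

∣∸-both⇒≡ : ∀ {n a a′} → n ∣ a′ ∸ a → n ∣ a ∸ a′ → a < n → a′ < n → a ≡ a′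
∣∸-both⇒≡ {a = a} {a′} n∣a′∸a n∣a∸a′ a<n a′<n = ≤-antisym
  (m∸n≡0⇒m≤n (∣∧<⇒≡0 n∣a∸a′ (≤-<-trans (m∸n≤m a a′) a<n)))
  (m∸n≡0⇒m≤n (∣∧<⇒≡0 n∣a′∸a (≤-<-trans (m∸n≤m a′ a) a′<n)))

_≟ᴱ_ : ∀ {ns} → DecidableEquality (Elem ns)
_≟ᴱ_ {[]} tt tt = yes refl
_≟ᴱ_ {n ∷ ns} (x , xs) (y , ys) with x Fin.≟ y | xs ≟ᴱ ys
... | yes refl | yes refl = yes refl
... | no x≢y | _ = no (λ { refl → x≢y refl })
... | yes _ | no xs≢ys = no (λ { refl → xs≢ys refl })

_∈ᴱ?_ : ∀ {ns} (x : Elem ns) (xs : List (Elem ns)) → Dec (x ∈ xs)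
_∈ᴱ?_ {ns} = _∈?_ (_≟ᴱ_ {ns})

elements : ∀ ns → List (Elem ns)
elements [] = tt ∷ []
elements (n ∷ ns) = cartesianProduct (allFin n) (elements ns)

elements-complete : ∀ {ns} (x : Elem ns) → x ∈ elements ns
elements-complete {[]} tt = here refl
elements-complete {n ∷ ns} (x , xs) = ∈-cartesianProduct⁺ (∈-allFin x) (elements-complete xs)

any-element? : ∀ {ns} {P : Elem ns → Set} → Decidable P → Dec (∃ P)
any-element? {ns} P? with any? P? (elements ns)
... | yes some = yes (Any.satisfied some)
... | no none = no (λ (x , px) → none (lose (elements-complete x) px))

cpow-toℕ : ∀ {m} a (x : Fin (suc m)) → toℕ (cpow a x) ≡ (a * toℕ x) % suc m
cpow-toℕ a x = Fin.toℕ-fromℕ< _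

cpow-zero : ∀ {m} b → cpow {suc m} b Fin.zero ≡ Fin.zero
cpow-zero {m} b = Fin.toℕ-injective (trans (cpow-toℕ b Fin.zero) (cong (_% suc m) (*-zeroʳ b)))

cpow-periodic : ∀ {n} a (x : Fin n) N .{{_ : NonZero N}} → n ∣ N → cpow a x ≡ cpow (a % N) x
cpow-periodic {suc m} a x N n∣N =
  Fin.toℕ-injective (trans (cpow-toℕ a x) (trans residue (sym (cpow-toℕ (a % N) x))))
  where
  open ≡-Reasoning
  residue : (a * toℕ x) % suc m ≡ ((a % N) * toℕ x) % suc m
  residue = begin
    (a * toℕ x) % suc m                          ≡⟨ %-distribˡ-* a (toℕ x) (suc m) ⟩
    ((a % suc m) * (toℕ x % suc m)) % suc m      ≡⟨ cong (λ r → (r * (toℕ x % suc m)) % suc m) (sym (m∣n⇒o%n%m≡o%m (suc m) N a n∣N)) ⟩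
    ((a % N % suc m) * (toℕ x % suc m)) % suc m  ≡⟨ sym (%-distribˡ-* (a % N) (toℕ x) (suc m)) ⟩
    ((a % N) * toℕ x) % suc m                    ∎

pow-periodic : ∀ {ns} a (w : Elem ns) N .{{_ : NonZero N}} → All (_∣ N) ns → pow a w ≡ pow (a % N) w
pow-periodic {[]} a w N _ = refl
pow-periodic {n ∷ ns} a (x , xs) N (n∣N ∷ ns∣N) =
  cong₂ _,_ (cpow-periodic a x N n∣N) (pow-periodic a xs N ns∣N)

moduli∣order : ∀ ns → All (_∣ product ns) ns
moduli∣order [] = []
moduli∣order (n ∷ ns) = m∣m*n (product ns) ∷ All.map (∣n⇒∣m*n n) (moduli∣order ns)

order-nonZero : ∀ {ns} → Elem ns → NonZero (product ns)
order-nonZero {[]} _ = _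
order-nonZero {suc n ∷ ns} (_ , xs) = m*n≢0 (suc n) (product ns) {{_}} {{order-nonZero xs}}

-- Being a power of w is decidable: only exponents below the group order need checking.
power-of? : ∀ {ns} (u w : Elem ns) → Dec (∃[ a ] u ≡ pow a w)
power-of? {ns} u w with order-nonZero u
... | nonZero with any? (λ a → u ≟ᴱ pow a w) (upTo (product ns))
... | yes some = yes (Any.satisfied some)
... | no none = no λ (a , u≡wᵃ) → none (lose (∈-upTo⁺ (m%n<n a (product ns) {{nonZero}}))
        (trans u≡wᵃ (pow-periodic a w (product ns) {{nonZero}} (moduli∣order ns))))

EAdj? : ∀ {ns} (u v : Elem ns) → Dec (EAdj u v)
EAdj? u v with u ≟ᴱ v
... | yes u≡v = no (λ adj → proj₁ adj u≡v)
... | no u≢v with any-element? (λ w → power-of? u w ×-dec power-of? v w)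
... | yes (w , (a , u≡wᵃ) , (b , v≡wᵇ)) = yes (u≢v , w , a , b , u≡wᵃ , v≡wᵇ)
... | no none = no (λ (_ , w , a , b , u≡wᵃ , v≡wᵇ) → none (w , (a , u≡wᵃ) , (b , v≡wᵇ)))

module Reachability {ns : List ℕ} (S : List (Elem ns)) (u : Elem ns) where

  Frontier : List (Elem ns) → Elem ns → Set
  Frontier R x = x ∉ R × x ∉ S × Any (λ v → EAdj v x) R

  frontier? : ∀ R → Decidable (Frontier R)
  frontier? R x = ¬? (x ∈ᴱ? R) ×-dec (¬? (x ∈ᴱ? S) ×-dec any? (λ v → EAdj? v x) R)

  Component : List (Elem ns) → Set
  Component R′ = All (Reach S u) R′ × (∀ y → Reach S u y → y ∈ R′)

  -- Growing a duplicate-free list of vertices reachable from u until it has no frontier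
  -- yields the whole component of u; the fuel k suffices because R cannot outgrow the group.
  explore : (k : ℕ) (R : List (Elem ns)) → Unique R → u ∈ R → All (Reach S u) R
    → length (elements ns) ≤ length R + k → ∃ Component
  explore k R uR u∈R reachR room with any? (frontier? R) (elements ns)
  ... | no closed = R , reachR , complete
    where
    complete : ∀ y → Reach S u y → y ∈ R
    complete y here = u∈R
    complete y (step {v = v} r adj y∉S) with y ∈ᴱ? R
    ... | yes y∈R = y∈R
    ... | no y∉R = ⊥-elim (closed (lose (elements-complete y) (y∉R , y∉S , lose (complete v r) adj)))
  ... | yes new with find new
  ... | x , _ , (x∉R , x∉S , adj) = grow k room
    where
    uxR : Unique (x ∷ R)
    uxR = All.tabulate (λ y∈R x≡y → x∉R (subst (_∈ R) (sym x≡y) y∈R)) ∷ uR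
    reach-x : Reach S u x
    reach-x with find adj
    ... | v , v∈R , v~x = step (All.lookup reachR v∈R) v~x x∉S
    -- Out of fuel, x ∷ R would list more distinct elements than the group has.
    grow : ∀ k → length (elements ns) ≤ length R + k → ∃ Component
    grow zero room = ⊥-elim (<⇒≱ (injection-length (λ y → y) uxR (λ {y} _ → elements-complete y) (λ _ _ e → e))
                                  (subst (length (elements ns) ≤_) (+-identityʳ _) room))
    grow (suc k) room = explore k (x ∷ R) uxR (there u∈R) (reach-x ∷ reachR)
                          (subst (length (elements ns) ≤_) (+-suc (length R) k) room)

  Reach? : Decidable (Reach S u)
  Reach? v with explore (length (elements ns)) (u ∷ []) ([] ∷ []) (here refl) (here ∷ []) (m≤n+m _ _)
  ... | R , reachR , complete with v ∈ᴱ? R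
  ... | yes v∈R = yes (All.lookup reachR v∈R)
  ... | no v∉R = no (λ r → v∉R (complete v r))

Separating? : ∀ {ns} → Decidable (Separating {ns})
Separating? S = allPairs? (λ x y → ¬? (x ≟ᴱ y)) S ×-dec
  any-element? (λ u → any-element? (λ v →
    ¬? (u ∈ᴱ? S) ×-dec (¬? (v ∈ᴱ? S) ×-dec ¬? (Reachability.Reach? S u v))))

listsOfLength : ∀ ns → ℕ → List (List (Elem ns))
listsOfLength ns zero = [] ∷ []
listsOfLength ns (suc m) = map (uncurry _∷_) (cartesianProduct (elements ns) (listsOfLength ns m))

listsOfLength-complete : ∀ {ns} (xs : List (Elem ns)) → xs ∈ listsOfLength ns (length xs)
listsOfLength-complete [] = here refl
listsOfLength-complete (x ∷ xs) =
  ∈-map⁺ (uncurry _∷_) (∈-cartesianProduct⁺ (elements-complete x) (listsOfLength-complete xs))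

listsOfLength-sound : ∀ {ns} m (xs : List (Elem ns)) → xs ∈ listsOfLength ns m → length xs ≡ m
listsOfLength-sound zero [] _ = refl
listsOfLength-sound zero (_ ∷ _) (here ())
listsOfLength-sound zero (_ ∷ _) (there ())
listsOfLength-sound {ns} (suc m) xs xs∈ with ∈-map⁻ (uncurry _∷_) xs∈
... | (y , ys) , ys∈ , refl =
  cong suc (listsOfLength-sound m ys (proj₂ (∈-cartesianProduct⁻ (elements ns) (listsOfLength ns m) ys∈)))

SeparatingOfSize : List ℕ → ℕ → Set
SeparatingOfSize ns m = ∃[ S ] (Separating {ns} S × length S ≡ m)

separatingOfSize? : ∀ ns → Decidable (SeparatingOfSize ns)
separatingOfSize? ns m with any? Separating? (listsOfLength ns m)
... | yes some with find some
...   | S , S∈ , sep = yes (S , sep , listsOfLength-sound m S S∈)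
separatingOfSize? ns m | no none =
  no (λ { (S , sep , refl) → none (lose (listsOfLength-complete S) sep) })

connectivity-exists : ∀ ns (S : List (Elem ns)) → Separating S
  → ∃[ κ ] (IsVertexConnectivity ns κ × κ ≤ length S)
connectivity-exists ns S sep with least-witness (separatingOfSize? ns) (length S) (S , sep , refl)
... | κ , witness , least =
  κ , (witness , λ T sepT → least (length T) (T , sepT , refl)) , least (length S) (S , sep , refl)

-- A cyclic factor Z_{p^t}, flagged as leading when it is the first factor of its prime.
Factor : Set
Factor = ℕ × ℕ × Bool

-- Its order p ^ t, written as a successor so that it indexes Fin directly.
modulus : Factor → ℕ
modulus (p , t , _) = suc (pred (p ^ t))

WellFormed : List Factor → Set
WellFormed = All (λ f → Prime (proj₁ f) × 1 ≤ proj₁ (proj₂ f))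

Leading NonLeading : Factor → Set
Leading f = proj₂ (proj₂ f) ≡ true
NonLeading f = proj₂ (proj₂ f) ≡ false

NonLeadingPrimesIn : List ℕ → List Factor → Set
NonLeadingPrimesIn Q = All (λ f → NonLeading f → proj₁ f ∈ Q)

leadingPrimes : List Factor → List ℕ
leadingPrimes [] = []
leadingPrimes ((p , t , true) ∷ fs) = p ∷ leadingPrimes fs
leadingPrimes ((p , t , false) ∷ fs) = leadingPrimes fs

leadingOrder : List Factor → ℕ
leadingOrder [] = 1
leadingOrder ((p , t , true) ∷ fs) = suc (pred (p ^ t)) * leadingOrder fs
leadingOrder ((p , t , false) ∷ fs) = leadingOrder fs

Group : List Factor → Set
Group fs = Elem (map modulus fs)

modulus≡ : ∀ {p} t → Prime p → suc (pred (p ^ t)) ≡ p ^ t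
modulus≡ {p} t pp = suc-pred (p ^ t) {{m^n≢0 p t {{prime⇒nonZero pp}}}}

p∣modulus : ∀ {p t} → Prime p → 1 ≤ t → p ∣ suc (pred (p ^ t))
p∣modulus {p} {suc t} pp _ = subst (p ∣_) (sym (modulus≡ (suc t) pp)) (m∣m*n (p ^ t))

1<modulus : ∀ {p t} → Prime p → 1 ≤ t → 1 < suc (pred (p ^ t))
1<modulus {p} {suc t} pp@(prime {{_}} _) _ =
  subst (1 <_) (sym (modulus≡ (suc t) pp)) (<-≤-trans (nonTrivial⇒n>1 p) p≤p^t+1)
  where
  p≤p^t+1 : p ≤ p * p ^ t
  p≤p^t+1 = subst (_≤ p * p ^ t) (*-identityʳ p) (*-monoʳ-≤ p (m^n>0 p {{prime⇒nonZero pp}} t))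

prime∤leadingOrder : ∀ {p} fs → WellFormed fs → Prime p → p ∉ leadingPrimes fs → ¬ p ∣ leadingOrder fs
prime∤leadingOrder [] _ pp _ p∣1 = prime≢1 pp (∣1⇒≡1 p∣1)
prime∤leadingOrder ((q , t , true) ∷ fs) ((pq , _) ∷ wf) pp p∉ p∣ with euclidsLemma _ (leadingOrder fs) pp p∣
... | inj₁ p∣q^t = p∉ (here (prime∣prime⇒≡ pp pq (prime∣^⇒∣ pp t (subst (_ ∣_) (modulus≡ t pq) p∣q^t))))
... | inj₂ p∣rest = prime∤leadingOrder fs wf pp (p∉ ∘ there) p∣rest
prime∤leadingOrder ((q , t , false) ∷ fs) (_ ∷ wf) pp p∉ p∣ = prime∤leadingOrder fs wf pp p∉ p∣

embed : ∀ fs → ℕ → Group fs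
embed [] k = tt
embed ((p , t , true) ∷ fs) k = fromℕ< (m%n<n k (suc (pred (p ^ t)))) , embed fs k
embed ((p , t , false) ∷ fs) k = Fin.zero , embed fs k

embed-≡⇒∣∸ : ∀ fs → WellFormed fs → Unique (leadingPrimes fs) → ∀ k k′ → embed fs k ≡ embed fs k′
  → leadingOrder fs ∣ k′ ∸ k
embed-≡⇒∣∸ [] _ _ k k′ _ = 1∣ _
embed-≡⇒∣∸ ((p , t , true) ∷ fs) ((pp , _) ∷ wf) (p∉ ∷ u) k k′ eq =
  subst (_∣ k′ ∸ k) (cong (_* leadingOrder fs) (sym (modulus≡ t pp)))
    (prime^*-∣ {t = t} pp (prime∤leadingOrder fs wf pp (λ p∈ → All.lookup p∉ p∈ refl))
      (subst (_∣ k′ ∸ k) (modulus≡ t pp) (%≡⇒∣∸ (suc (pred (p ^ t))) k k′ residues))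
      (embed-≡⇒∣∸ fs wf u k k′ (cong proj₂ eq)))
  where
  residues : k % suc (pred (p ^ t)) ≡ k′ % suc (pred (p ^ t))
  residues = trans (sym (Fin.toℕ-fromℕ< _)) (trans (cong (toℕ ∘ proj₁) eq) (Fin.toℕ-fromℕ< _))
embed-≡⇒∣∸ ((p , t , false) ∷ fs) (_ ∷ wf) u k k′ eq = embed-≡⇒∣∸ fs wf u k k′ (cong proj₂ eq)

embed-injective : ∀ fs → WellFormed fs → Unique (leadingPrimes fs) → ∀ c {j j′}
  → j < leadingOrder fs → j′ < leadingOrder fs → embed fs (c + j) ≡ embed fs (c + j′) → j ≡ j′
embed-injective fs wf u c {j} {j′} j< j′< eq = ∣∸-both⇒≡
  (subst (leadingOrder fs ∣_) ([m+n]∸[m+o]≡n∸o c j′ j) (embed-≡⇒∣∸ fs wf u _ _ eq))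
  (subst (leadingOrder fs ∣_) ([m+n]∸[m+o]≡n∸o c j j′) (embed-≡⇒∣∸ fs wf u _ _ (sym eq)))
  j< j′<

pow-embed : ∀ fs a → pow a (embed fs 1) ≡ embed fs a
pow-embed [] a = refl
pow-embed ((p , t , true) ∷ fs) a = cong₂ _,_ (Fin.toℕ-injective residue) (pow-embed fs a)
  where
  m : ℕ
  m = suc (pred (p ^ t))
  open ≡-Reasoning
  residue : toℕ (cpow a (fromℕ< (m%n<n 1 m))) ≡ toℕ (fromℕ< (m%n<n a m))
  residue = begin
    toℕ (cpow a (fromℕ< (m%n<n 1 m)))  ≡⟨ cpow-toℕ a _ ⟩
    (a * toℕ (fromℕ< (m%n<n 1 m))) % m ≡⟨ cong (λ r → (a * r) % m) (Fin.toℕ-fromℕ< _) ⟩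
    (a * (1 % m)) % m                  ≡⟨ %-distribˡ-* a (1 % m) m ⟩
    ((a % m) * (1 % m % m)) % m        ≡⟨ cong (λ r → ((a % m) * r) % m) (m%n%n≡m%n 1 m) ⟩
    ((a % m) * (1 % m)) % m            ≡⟨ sym (%-distribˡ-* a 1 m) ⟩
    (a * 1) % m                        ≡⟨ cong (_% m) (*-identityʳ a) ⟩
    a % m                              ≡⟨ sym (Fin.toℕ-fromℕ< _) ⟩
    toℕ (fromℕ< (m%n<n a m))           ∎
pow-embed ((p , t , false) ∷ fs) a = cong₂ _,_ (cpow-zero a) (pow-embed fs a)

InLeading : ∀ fs → Group fs → Set
InLeading [] _ = ⊤
InLeading ((p , t , true) ∷ fs) (x , xs) = InLeading fs xs
InLeading ((p , t , false) ∷ fs) (x , xs) = x ≡ Fin.zero × InLeading fs xs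

IsLeadingUnit : ∀ fs → Group fs → Set
IsLeadingUnit [] _ = ⊤
IsLeadingUnit ((p , t , true) ∷ fs) (x , xs) = ¬ (p ∣ toℕ x) × IsLeadingUnit fs xs
IsLeadingUnit ((p , t , false) ∷ fs) (x , xs) = x ≡ Fin.zero × IsLeadingUnit fs xs

isLeadingUnit? : ∀ fs → Decidable (IsLeadingUnit fs)
isLeadingUnit? [] _ = yes tt
isLeadingUnit? ((p , t , true) ∷ fs) (x , xs) = ¬? (p ∣? toℕ x) ×-dec isLeadingUnit? fs xs
isLeadingUnit? ((p , t , false) ∷ fs) (x , xs) = (x Fin.≟ Fin.zero) ×-dec isLeadingUnit? fs xs

unit⇒InLeading : ∀ fs x → IsLeadingUnit fs x → InLeading fs x
unit⇒InLeading [] _ _ = tt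
unit⇒InLeading ((p , t , true) ∷ fs) (x , xs) (_ , uxs) = unit⇒InLeading fs xs uxs
unit⇒InLeading ((p , t , false) ∷ fs) (x , xs) (x≡0 , uxs) = x≡0 , unit⇒InLeading fs xs uxs

all-InLeading : ∀ fs → All Leading fs → ∀ x → InLeading fs x
all-InLeading [] _ _ = tt
all-InLeading ((p , t , true) ∷ fs) (_ ∷ leading) (x , xs) = all-InLeading fs leading xs
all-InLeading ((p , t , false) ∷ fs) (() ∷ _) _

embed-InLeading : ∀ fs k → InLeading fs (embed fs k)
embed-InLeading [] k = tt
embed-InLeading ((p , t , true) ∷ fs) k = embed-InLeading fs k
embed-InLeading ((p , t , false) ∷ fs) k = refl , embed-InLeading fs k

leadingElements : ∀ fs → List (Group fs)
leadingElements [] = tt ∷ []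
leadingElements ((p , t , true) ∷ fs) = cartesianProduct (allFin _) (leadingElements fs)
leadingElements ((p , t , false) ∷ fs) = map (Fin.zero ,_) (leadingElements fs)

leadingElements-complete : ∀ fs x → InLeading fs x → x ∈ leadingElements fs
leadingElements-complete [] tt _ = here refl
leadingElements-complete ((p , t , true) ∷ fs) (x , xs) xs∈T =
  ∈-cartesianProduct⁺ (∈-allFin x) (leadingElements-complete fs xs xs∈T)
leadingElements-complete ((p , t , false) ∷ fs) (x , xs) (refl , xs∈T) =
  ∈-map⁺ (Fin.zero ,_) (leadingElements-complete fs xs xs∈T)

leadingElements-sound : ∀ fs x → x ∈ leadingElements fs → InLeading fs x
leadingElements-sound [] tt _ = tt
leadingElements-sound ((p , t , true) ∷ fs) (x , xs) x∈ =
  leadingElements-sound fs xs (proj₂ (∈-cartesianProduct⁻ (allFin _) (leadingElements fs) x∈))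
leadingElements-sound ((p , t , false) ∷ fs) (x , xs) x∈ with ∈-map⁻ (Fin.zero ,_) x∈
... | _ , xs∈ , refl = refl , leadingElements-sound fs xs xs∈

leadingElements-unique : ∀ fs → Unique (leadingElements fs)
leadingElements-unique [] = [] ∷ []
leadingElements-unique ((p , t , true) ∷ fs) =
  Unique.cartesianProduct⁺ (Unique.allFin⁺ _) (leadingElements-unique fs)
leadingElements-unique ((p , t , false) ∷ fs) = Unique.map⁺ (cong proj₂) (leadingElements-unique fs)

leadingElements-length : ∀ fs → length (leadingElements fs) ≡ leadingOrder fs
leadingElements-length [] = refl
leadingElements-length ((p , t , true) ∷ fs) =
  trans (length-cartesianProduct (allFin _) (leadingElements fs))
    (cong₂ _*_ (length-tabulate {n = suc (pred (p ^ t))} (λ x → x)) (leadingElements-length fs))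
leadingElements-length ((p , t , false) ∷ fs) =
  trans (length-map _ (leadingElements fs)) (leadingElements-length fs)

embed-unit : ∀ fs N k → WellFormed fs → leadingOrder fs ∣ N → gcd k N ≡ 1 → IsLeadingUnit fs (embed fs k)
embed-unit [] N k _ _ _ = tt
embed-unit ((p , t , true) ∷ fs) N k ((pp , t≥1) ∷ wf) order∣N coprime =
  p∤k%m , embed-unit fs N k wf (∣-trans (n∣m*n (suc (pred (p ^ t)))) order∣N) coprime
  where
  m : ℕ
  m = suc (pred (p ^ t))
  p∤k%m : ¬ p ∣ toℕ (fromℕ< (m%n<n k m))
  p∤k%m p∣ = prime≢1 pp (∣1⇒≡1 (subst (p ∣_) coprime (gcd-greatest p∣k p∣N)))
    where
    p∣k : p ∣ k
    p∣k = ∣n∣m%n⇒∣m (p∣modulus pp t≥1) (subst (p ∣_) (Fin.toℕ-fromℕ< _) p∣)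
    p∣N : p ∣ N
    p∣N = ∣-trans (p∣modulus pp t≥1) (∣-trans (m∣m*n (leadingOrder fs)) order∣N)
embed-unit ((p , t , false) ∷ fs) N k (_ ∷ wf) order∣N coprime = refl , embed-unit fs N k wf order∣N coprime

unit-power⇒exponent-coprime : ∀ fs a (w : Group fs) → WellFormed fs → IsLeadingUnit fs (pow a w)
  → All (λ p → ¬ p ∣ a) (leadingPrimes fs)
unit-power⇒exponent-coprime [] a w _ _ = []
unit-power⇒exponent-coprime ((p , t , true) ∷ fs) a (x , xs) ((pp , t≥1) ∷ wf) (p∤xᵃ , unit) =
  p∤a ∷ unit-power⇒exponent-coprime fs a xs wf unit
  where
  p∤a : ¬ p ∣ a
  p∤a p∣a = p∤xᵃ (subst (p ∣_) (sym (cpow-toℕ a x)) (%-presˡ-∣ (∣m⇒∣m*n (toℕ x) p∣a) (p∣modulus pp t≥1)))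
unit-power⇒exponent-coprime ((p , t , false) ∷ fs) a (x , xs) (_ ∷ wf) (_ , unit) =
  unit-power⇒exponent-coprime fs a xs wf unit

-- If w ^ a ∈ T for an a prime to the non-leading primes, the non-leading coordinates of w
-- vanish already, so every power of w lies in T.
powers-in-leading : ∀ fs Q a (w : Group fs) → WellFormed fs → All (λ p → ¬ p ∣ a) Q
  → NonLeadingPrimesIn Q fs → InLeading fs (pow a w) → ∀ b → InLeading fs (pow b w)
powers-in-leading [] Q a w _ _ _ _ b = tt
powers-in-leading ((p , t , true) ∷ fs) Q a (x , xs) (_ ∷ wf) a-coprime (_ ∷ nl) wᵃ∈T b =
  powers-in-leading fs Q a xs wf a-coprime nl wᵃ∈T b
powers-in-leading ((p , t , false) ∷ fs) Q a (x , xs) ((pp , _) ∷ wf) a-coprime (p∈Q ∷ nl) (xᵃ≡0 , wᵃ∈T) b =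
  trans (cong (cpow b) x≡0) (cpow-zero b) , powers-in-leading fs Q a xs wf a-coprime nl wᵃ∈T b
  where
  m : ℕ
  m = suc (pred (p ^ t))
  m∣a*x : m ∣ a * toℕ x
  m∣a*x = m%n≡0⇒n∣m (a * toℕ x) m (trans (sym (cpow-toℕ a x)) (cong toℕ xᵃ≡0))
  m∣x : m ∣ toℕ x
  m∣x = subst (_∣ toℕ x) (sym (modulus≡ t pp))
    (prime^∣*-cancel pp (All.lookup a-coprime (p∈Q refl)) t (subst (_∣ a * toℕ x) (modulus≡ t pp) m∣a*x))
  x≡0 : x ≡ Fin.zero
  x≡0 = Fin.toℕ-injective (∣∧<⇒≡0 m∣x (Fin.toℕ<n x))

all-leading⇒cyclic : ∀ fs → WellFormed fs → Unique (leadingPrimes fs) → All Leading fs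
  → IsCyclic (map modulus fs)
all-leading⇒cyclic fs wf u leading = embed fs 1 , generated
  where
  n : ℕ
  n = leadingOrder fs
  generated : ∀ x → ∃[ a ] x ≡ pow a (embed fs 1)
  generated x with injection-onto _≟ᴱ_ (embed fs) (Unique.upTo⁺ n)
                     (λ _ → leadingElements-complete fs _ (embed-InLeading fs _))
                     (λ a b → embed-injective fs wf u 0 (∈-upTo⁻ a) (∈-upTo⁻ b))
                     (≤-reflexive (trans (leadingElements-length fs) (sym (length-upTo n))))
                     (leadingElements-complete fs x (all-InLeading fs leading x))
  ... | a , _ , embed-a≡x = a , trans (sym embed-a≡x) (sym (pow-embed fs a))

outside-leading : ∀ fs → WellFormed fs → Any NonLeading fs → ∃[ x ] ¬ InLeading fs x
outside-leading ((p , t , true) ∷ fs) _ (here ())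
outside-leading ((p , t , false) ∷ fs) ((pp , t≥1) ∷ wf) (here _) =
  (fromℕ< (1<modulus pp t≥1) , embed fs 0) ,
  λ (x≡0 , _) → 1+n≢0 (trans (sym (Fin.toℕ-fromℕ< (1<modulus pp t≥1))) (cong toℕ x≡0))
outside-leading ((p , t , true) ∷ fs) (_ ∷ wf) (there nonLeading) with outside-leading fs wf nonLeading
... | x , x∉T = (Fin.zero , x) , x∉T
outside-leading ((p , t , false) ∷ fs) (_ ∷ wf) (there nonLeading) with outside-leading fs wf nonLeading
... | x , x∉T = (Fin.zero , x) , x∉T ∘ proj₂

all-leading-or-not : ∀ fs → All Leading fs ⊎ Any NonLeading fs
all-leading-or-not [] = inj₁ []
all-leading-or-not ((p , t , false) ∷ fs) = inj₂ (here refl)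
all-leading-or-not ((p , t , true) ∷ fs) with all-leading-or-not fs
... | inj₁ leading = inj₁ (refl ∷ leading)
... | inj₂ nonLeading = inj₂ (there nonLeading)

module LeadingSeparator (fs : List Factor) (wf : WellFormed fs) (u : Unique (leadingPrimes fs))
                        (nl : NonLeadingPrimesIn (leadingPrimes fs) fs) where

  n : ℕ
  n = leadingOrder fs

  units separator : List (Group fs)
  units = filter (isLeadingUnit? fs) (leadingElements fs)
  separator = filter (¬? ∘ isLeadingUnit? fs) (leadingElements fs)

  reach-stays-unit : ∀ {x y} → IsLeadingUnit fs x → Reach separator x y → IsLeadingUnit fs y
  reach-stays-unit ux here = ux
  reach-stays-unit ux (step r (_ , w , a , b , refl , refl) wᵇ∉S) with isLeadingUnit? fs (pow b w)
  ... | yes unit = unit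
  ... | no nonUnit = ⊥-elim (wᵇ∉S (∈-filter⁺ (¬? ∘ isLeadingUnit? fs) (leadingElements-complete fs _ wᵇ∈T) nonUnit))
    where
    wᵃ-unit : IsLeadingUnit fs (pow a w)
    wᵃ-unit = reach-stays-unit ux r
    wᵇ∈T : InLeading fs (pow b w)
    wᵇ∈T = powers-in-leading fs (leadingPrimes fs) a w wf (unit-power⇒exponent-coprime fs a w wf wᵃ-unit)
             nl (unit⇒InLeading fs _ wᵃ-unit) b

  separates : Any NonLeading fs → Separating separator
  separates nonLeading =
    Unique.filter⁺ (¬? ∘ isLeadingUnit? fs) (leadingElements-unique fs) ,
    embed fs 1 , outsider , generator∉S , outsider∉S ,
    λ r → outsider∉T (unit⇒InLeading fs outsider (reach-stays-unit generator r))
    where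
    generator : IsLeadingUnit fs (embed fs 1)
    generator = embed-unit fs n 1 wf ∣-refl (∣1⇒≡1 (gcd[m,n]∣m 1 n))
    outsider : Group fs
    outsider = proj₁ (outside-leading fs wf nonLeading)
    outsider∉T : ¬ InLeading fs outsider
    outsider∉T = proj₂ (outside-leading fs wf nonLeading)
    generator∉S : embed fs 1 ∉ separator
    generator∉S g∈S = proj₂ (∈-filter⁻ (¬? ∘ isLeadingUnit? fs) {xs = leadingElements fs} g∈S) generator
    outsider∉S : outsider ∉ separator
    outsider∉S o∈S = outsider∉T (leadingElements-sound fs outsider
                       (proj₁ (∈-filter⁻ (¬? ∘ isLeadingUnit? fs) {xs = leadingElements fs} o∈S)))

  -- k ↦ embed k maps the totatives 1 ≤ k ≤ n of n injectively to generators of T.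
  φ≤units : φ n ≤ length units
  φ≤units = injection-length (embed fs) (Unique.filter⁺ coprime? (Unique.map⁺ suc-injective (Unique.upTo⁺ n)))
              into injective
    where
    coprime? : Decidable (λ k → gcd k n ≡ 1)
    coprime? k = gcd k n ≟ 1
    totatives : List ℕ
    totatives = filter coprime? (map suc (upTo n))
    into : MapsInto (embed fs) totatives units
    into {k} k∈ = ∈-filter⁺ (isLeadingUnit? fs) (leadingElements-complete fs _ (embed-InLeading fs k))
      (embed-unit fs n k wf ∣-refl (proj₂ (∈-filter⁻ coprime? {xs = map suc (upTo n)} k∈)))
    injective : InjectiveOn (embed fs) totatives
    injective k∈ k′∈ eq with ∈-map⁻ suc (proj₁ (∈-filter⁻ coprime? {xs = map suc (upTo n)} k∈))
                            | ∈-map⁻ suc (proj₁ (∈-filter⁻ coprime? {xs = map suc (upTo n)} k′∈))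
    ... | j , j∈ , refl | j′ , j′∈ , refl = cong suc (embed-injective fs wf u 1 (∈-upTo⁻ j∈) (∈-upTo⁻ j′∈) eq)

  separator-length : length separator ≤ n ∸ φ n
  separator-length = begin
    length separator                                  ≡⟨ sym (m+n∸m≡n (length units) (length separator)) ⟩
    (length units + length separator) ∸ length units  ≡⟨ cong (_∸ length units) split ⟩
    n ∸ length units                                  ≤⟨ ∸-monoʳ-≤ n φ≤units ⟩
    n ∸ φ n                                           ∎
    where
    open ≤-Reasoning
    split : length units + length separator ≡ n
    split = trans (length-filter-split (isLeadingUnit? fs) (leadingElements fs)) (leadingElements-length fs)

  connectivity≤ : Any NonLeading fs → ∃[ κ ] (IsVertexConnectivity (map modulus fs) κ × κ ≤ n ∸ φ n)
  connectivity≤ nonLeading with connectivity-exists (map modulus fs) separator (separates nonLeading)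
  ... | κ , isκ , κ≤|S| = κ , isκ , ≤-trans κ≤|S| separator-length

connectivity-bound : ∀ fs → WellFormed fs → Unique (leadingPrimes fs) → NonLeadingPrimesIn (leadingPrimes fs) fs
  → ¬ IsCyclic (map modulus fs)
  → ∃[ κ ] (IsVertexConnectivity (map modulus fs) κ × κ ≤ leadingOrder fs ∸ φ (leadingOrder fs))
connectivity-bound fs wf u nl nonCyclic with all-leading-or-not fs
... | inj₁ leading = ⊥-elim (nonCyclic (all-leading⇒cyclic fs wf u leading))
... | inj₂ nonLeading = LeadingSeparator.connectivity≤ fs wf u nl nonLeading

blockFactors : ℕ → Bool → List ℕ → List Factor
blockFactors p leading [] = []
blockFactors p leading (t ∷ ts) = (p , t , leading) ∷ blockFactors p false ts

factors : List Block → List Factor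
factors [] = []
factors ((p , ts) ∷ bs) = blockFactors p true ts ++ factors bs

leadingPrimes-++ : ∀ fs gs → leadingPrimes (fs ++ gs) ≡ leadingPrimes fs ++ leadingPrimes gs
leadingPrimes-++ [] gs = refl
leadingPrimes-++ ((p , t , true) ∷ fs) gs = cong (p ∷_) (leadingPrimes-++ fs gs)
leadingPrimes-++ ((p , t , false) ∷ fs) gs = leadingPrimes-++ fs gs

leadingOrder-++ : ∀ fs gs → leadingOrder (fs ++ gs) ≡ leadingOrder fs * leadingOrder gs
leadingOrder-++ [] gs = sym (+-identityʳ _)
leadingOrder-++ ((p , t , true) ∷ fs) gs =
  trans (cong (suc (pred (p ^ t)) *_) (leadingOrder-++ fs gs))
        (sym (*-assoc (suc (pred (p ^ t))) (leadingOrder fs) (leadingOrder gs)))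
leadingOrder-++ ((p , t , false) ∷ fs) gs = leadingOrder-++ fs gs

leadingPrimes-tail : ∀ p ts → leadingPrimes (blockFactors p false ts) ≡ []
leadingPrimes-tail p [] = refl
leadingPrimes-tail p (t ∷ ts) = leadingPrimes-tail p ts

leadingOrder-tail : ∀ p ts → leadingOrder (blockFactors p false ts) ≡ 1
leadingOrder-tail p [] = refl
leadingOrder-tail p (t ∷ ts) = leadingOrder-tail p ts

moduli-factors : ∀ bs → All ValidBlock bs → moduli bs ≡ map modulus (factors bs)
moduli-factors [] _ = refl
moduli-factors ((p , ts) ∷ bs) ((pp , _) ∷ valid) =
  sym (trans (map-++ modulus (blockFactors p true ts) (factors bs))
             (cong₂ _++_ (block-moduli true ts) (sym (moduli-factors bs valid))))
  where
  block-moduli : ∀ leading ts → map modulus (blockFactors p leading ts) ≡ map (p ^_) ts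
  block-moduli _ [] = refl
  block-moduli leading (t ∷ ts) = cong₂ _∷_ (modulus≡ t pp) (block-moduli false ts)

factors-wellFormed : ∀ bs → All ValidBlock bs → WellFormed (factors bs)
factors-wellFormed [] _ = []
factors-wellFormed ((p , ts) ∷ bs) ((pp , _ , ts≥1 , _) ∷ valid) =
  All.++⁺ (block-wellFormed true ts ts≥1) (factors-wellFormed bs valid)
  where
  block-wellFormed : ∀ leading ts → All (1 ≤_) ts → WellFormed (blockFactors p leading ts)
  block-wellFormed _ [] _ = []
  block-wellFormed _ (t ∷ ts) (t≥1 ∷ ts≥1) = (pp , t≥1) ∷ block-wellFormed false ts ts≥1

leadingPrimes-factors : ∀ bs → All ValidBlock bs → leadingPrimes (factors bs) ≡ map proj₁ bs
leadingPrimes-factors [] _ = refl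
leadingPrimes-factors ((p , []) ∷ bs) ((_ , () , _) ∷ _)
leadingPrimes-factors ((p , t ∷ ts) ∷ bs) (_ ∷ valid) =
  trans (leadingPrimes-++ (blockFactors p true (t ∷ ts)) (factors bs))
        (cong₂ (λ tail rest → p ∷ tail ++ rest) (leadingPrimes-tail p ts) (leadingPrimes-factors bs valid))

leadingOrder-factors : ∀ bs → All ValidBlock bs → leadingOrder (factors bs) ≡ bound bs
leadingOrder-factors [] _ = refl
leadingOrder-factors ((p , []) ∷ bs) ((_ , () , _) ∷ _)
leadingOrder-factors ((p , t ∷ ts) ∷ bs) ((pp , _) ∷ valid) =
  trans (leadingOrder-++ (blockFactors p true (t ∷ ts)) (factors bs))
        (cong₂ _*_ first-factor (leadingOrder-factors bs valid))
  where
  first-factor : suc (pred (p ^ t)) * leadingOrder (blockFactors p false ts) ≡ p ^ t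
  first-factor = trans (cong (suc (pred (p ^ t)) *_) (leadingOrder-tail p ts))
                       (trans (*-identityʳ _) (modulus≡ t pp))

factors-nonLeadingPrimes : ∀ Q bs → All (λ b → proj₁ b ∈ Q) bs → NonLeadingPrimesIn Q (factors bs)
factors-nonLeadingPrimes Q [] _ = []
factors-nonLeadingPrimes Q ((p , ts) ∷ bs) (p∈Q ∷ primes∈Q) =
  All.++⁺ (block-primes true ts) (factors-nonLeadingPrimes Q bs primes∈Q)
  where
  block-primes : ∀ leading ts → NonLeadingPrimesIn Q (blockFactors p leading ts)
  block-primes _ [] = []
  block-primes _ (t ∷ ts) = (λ _ → p∈Q) ∷ block-primes false ts

mainTheorem5 : (bs : List Block)
    → All ValidBlock bs
    → Unique (map proj₁ bs)
    → ¬ IsCyclic (moduli bs)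
    → ∃[ κ ] (IsVertexConnectivity (moduli bs) κ × κ ≤ bound bs ∸ φ (bound bs))
mainTheorem5 bs valid distinct nonCyclic =
  subst₂ (λ ns n → ∃[ κ ] (IsVertexConnectivity ns κ × κ ≤ n ∸ φ n))
    (sym (moduli-factors bs valid)) (leadingOrder-factors bs valid)
    (connectivity-bound (factors bs) (factors-wellFormed bs valid) distinct′ nonLeading
      (nonCyclic ∘ subst IsCyclic (sym (moduli-factors bs valid))))
  where
  distinct′ : Unique (leadingPrimes (factors bs))
  distinct′ = subst Unique (sym (leadingPrimes-factors bs valid)) distinct
  nonLeading : NonLeadingPrimesIn (leadingPrimes (factors bs)) (factors bs)
  nonLeading = subst (λ Q → NonLeadingPrimesIn Q (factors bs)) (sym (leadingPrimes-factors bs valid))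
                 (factors-nonLeadingPrimes (map proj₁ bs) bs (All.tabulate (∈-map⁺ proj₁)))
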